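{- Let $G$ and $H$ be non-empty connected graphs such that $G$ has a $c$-deletion set of size at most $k$. If there is a locally surjective homomorphism $\phi$ from $G$ to $H$, then there are a set $D\subseteq D_G^{k+c}$ and a locally surjective homomorphism $\phi_P$ from $G[D]$ to $H[D_H^{k+c}]$ such that $\phi$ augments $\phi_P$. If $\phi$ is locally bijective, then $D=D_G^{k+c}$ and $\phi_P$ is a locally bijective homomorphism.
   Context: $G$ has no self-loops; $H$ may have self-loops (with $u\in N_H(u)$ if $uu\in E(H)$). For a graph $X$ and integer $m$, $D_X^m=\{v\in V(X):\deg_X(v)\ge m\}$. A $c$-deletion set of $G$: a set $S\subseteq V(G)$ such that every component of $G\setminus S$ has at most $c$ vertices. A homomorphism is locally surjective (resp. bijective) if for every vertex $u$ its restriction to $N(u)$ is surjective (resp. bijective) onto the neighbourhood of the image of $u$. $\phi:V(G)\to V(H)$ augments a partial map $\phi_P:V_G\to V_H$ if $v\in V_G\Leftrightarrow\phi(v)\in V_H$ for every $v\in V(G)$ and the restriction of $\phi$ to $V_G$ equals $\phi_P$. -}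

module Defs where

open import Level using (0ℓ)
open import Data.Nat using (ℕ; _≤_; _+_)
open import Data.Fin using (Fin)
open import Data.Fin.Subset using (Subset; _∈_; _∉_; ∣_∣)
open import Data.Product using (Σ; ∃; _×_; _,_; proj₁)
open import Relation.Binary.PropositionalEquality using (_≡_)
open import Relation.Binary.Construct.Closure.ReflexiveTransitive using (Star)
open import Relation.Nullary using (¬_)
open import Function.Bundles using (_⇔_)

record Graph : Set₁ where
  field
    V   : Set
    Adj : V → V → Set
open Graph public

Induced : (X : Graph) → (V X → Set) → Graph
Induced X P = record { V = Σ (V X) P ; Adj = λ u v → Adj X (proj₁ u) (proj₁ v) }

module _ (X Y : Graph) where
  IsHom : (V X → V Y) → Set
  IsHom f = ∀ u v → Adj X u v → Adj Y (f u) (f v)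

  LocSurj : (V X → V Y) → Set
  LocSurj f = IsHom f × (∀ u y → Adj Y (f u) y → ∃ λ v → Adj X u v × f v ≡ y)

  LocBij : (V X → V Y) → Set
  LocBij f = LocSurj f × (∀ u v w → Adj X u v → Adj X u w → f v ≡ f w → v ≡ w)

Connected : Graph → Set
Connected X = ∀ u v → Star (Adj X) u v

-- Finite graph on vertex set Fin n; N(u) = nbr u (a self-loop at u means u ∈ nbr u).
record FinGraph (n : ℕ) : Set where
  field
    nbr : Fin n → Subset n
    sym : ∀ u v → v ∈ nbr u → u ∈ nbr v
open FinGraph public

Loopless : ∀ {n} → FinGraph n → Set
Loopless X = ∀ u → u ∉ nbr X u

toGraph : ∀ {n} → FinGraph n → Graph
toGraph {n} X = record { V = Fin n ; Adj = λ u v → v ∈ nbr X u }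

deg : ∀ {n} → FinGraph n → Fin n → ℕ
deg X v = ∣ nbr X v ∣

InD : ∀ {n} → FinGraph n → ℕ → Fin n → Set
InD X m v = m ≤ deg X v

-- S is a c-deletion set: every component of X \ S has at most c vertices,
-- i.e. for every vertex x of X \ S, every set T of vertices reachable from x
-- in X \ S has size at most c.
DeletionSet : ∀ {n} → FinGraph n → ℕ → Subset n → Set
DeletionSet {n} X c S =
  ∀ (x : V (Induced (toGraph X) (λ v → v ∉ S))) (T : Subset n) →
    (∀ w → w ∈ T → Σ (w ∉ S) λ q →
        Star (Adj (Induced (toGraph X) (λ v → v ∉ S))) x (w , q)) →
    ∣ T ∣ ≤ c

Augments : ∀ {n m} (PG : Fin n → Set) (PH : Fin m → Set) →
  (Fin n → Fin m) → (Σ (Fin n) PG → Σ (Fin m) PH) → Set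
Augments PG PH φ φP =
  (∀ v → PG v ⇔ PH (φ v)) × (∀ v (p : PG v) → proj₁ (φP (v , p)) ≡ φ v)

{-# OPTIONS --safe #-}
module Submission where

-- Take D := φ⁻¹(D_H^{k+c}) and let φP be the restriction of φ.  Local
-- surjectivity makes φ inject a choice of preimages of N_H(φ v) into N_G(v),
-- so deg_H(φ v) ≤ deg_G(v) and D ⊆ D_G^{k+c}; local bijectivity gives equality
-- of degrees and hence D = D_G^{k+c}.  Restricting φ to the preimage of a set
-- preserves local surjectivity and local injectivity.

open import Defs hiding (sym)
open import Data.Nat using (ℕ; _≤_; _<_; _+_; z≤n; s≤s; _≤?_)
open import Data.Nat.Properties using (≤-trans; ≤-antisym; ≤-irrelevant)
open import Data.Fin using (Fin; zero; suc)
open import Data.Fin.Properties using (suc-injective; 0≢1+n)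
open import Data.Fin.Subset using (Subset; _∈_; ∣_∣; inside; outside; _-_)
open import Data.Fin.Subset.Properties using (x∈p⇒∣p-x∣<∣p∣; x∈p∧x≢y⇒x∈p-y)
open import Data.Vec using (_∷_; []; here; there; lookup; tabulate)
open import Data.Vec.Properties using (lookup∘tabulate; []=⇒lookup; lookup⇒[]=)
open import Data.Vec.Properties.WithK using ([]=-irrelevant)
open import Data.Bool using (true)
open import Data.Product using (Σ; ∃; _×_; _,_; proj₁; proj₂)
open import Function using (_∘_)
open import Function.Bundles using (_⇔_; mk⇔; Equivalence)
open import Level using (Level)
open import Relation.Nullary using (does; proof)
open import Relation.Nullary.Decidable using (dec-true)
open import Relation.Nullary.Reflects using (Reflects; invert)
open import Relation.Unary using (Pred; Decidable; Irrelevant)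
open import Relation.Binary.PropositionalEquality
  using (_≡_; refl; sym; trans; cong; subst)

open Equivalence using (to; from)

private
  variable
    ℓ : Level
    n m : ℕ

injection⇒∣p∣≤∣q∣ : {p : Subset n} {q : Subset m} (f : ∀ x → x ∈ p → Fin m) →
  (∀ x x∈p → f x x∈p ∈ q) →
  (∀ x y x∈p y∈p → f x x∈p ≡ f y y∈p → x ≡ y) →
  ∣ p ∣ ≤ ∣ q ∣
injection⇒∣p∣≤∣q∣ {p = []} _ _ _ = z≤n
injection⇒∣p∣≤∣q∣ {p = outside ∷ p} f f∈q f-inj =
  injection⇒∣p∣≤∣q∣ (λ x → f (suc x) ∘ there) (λ x → f∈q (suc x) ∘ there)
    (λ x y x∈p y∈p → suc-injective ∘ f-inj (suc x) (suc y) (there x∈p) (there y∈p))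
injection⇒∣p∣≤∣q∣ {p = inside ∷ p} {q} f f∈q f-inj =
  ≤-trans (s≤s ∣p∣≤∣q-f₀∣) (x∈p⇒∣p-x∣<∣p∣ (f∈q zero here))
  where
  ∣p∣≤∣q-f₀∣ : ∣ p ∣ ≤ ∣ q - f zero here ∣
  ∣p∣≤∣q-f₀∣ = injection⇒∣p∣≤∣q∣ (λ x → f (suc x) ∘ there)
    (λ x x∈p → x∈p∧x≢y⇒x∈p-y (f∈q (suc x) (there x∈p))
                 (0≢1+n ∘ sym ∘ f-inj (suc x) zero (there x∈p) here))
    (λ x y x∈p y∈p → suc-injective ∘ f-inj (suc x) (suc y) (there x∈p) (there y∈p))

module _ (G : FinGraph n) (H : FinGraph m) {φ : Fin n → Fin m} where

  locSurj⇒deg≤ : LocSurj (toGraph G) (toGraph H) φ → ∀ v → deg H (φ v) ≤ deg G v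
  locSurj⇒deg≤ (_ , surj) v =
    injection⇒∣p∣≤∣q∣ (λ y → proj₁ ∘ surj v y) (λ y → proj₁ ∘ proj₂ ∘ surj v y) preimage-inj
    where
    preimage-inj : ∀ y y′ y∈N y′∈N → proj₁ (surj v y y∈N) ≡ proj₁ (surj v y′ y′∈N) → y ≡ y′
    preimage-inj y y′ y∈N y′∈N eq =
      trans (sym (proj₂ (proj₂ (surj v y y∈N))))
            (trans (cong φ eq) (proj₂ (proj₂ (surj v y′ y′∈N))))

  locBij⇒deg≡ : LocBij (toGraph G) (toGraph H) φ → ∀ v → deg H (φ v) ≡ deg G v
  locBij⇒deg≡ (ls , inj) v =
    ≤-antisym (locSurj⇒deg≤ ls v) (injection⇒∣p∣≤∣q∣ (λ x _ → φ x) (proj₁ ls v) (inj v))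

module Restriction {X Y : Graph} {φ : V X → V Y} {P : V X → Set} {Q : V Y → Set}
                   (P⇔Q∘φ : ∀ v → P v ⇔ Q (φ v)) where

  restrict : Σ (V X) P → Σ (V Y) Q
  restrict (v , p) = φ v , to (P⇔Q∘φ v) p

  restrict-locSurj : Irrelevant Q → LocSurj X Y φ →
    LocSurj (Induced X P) (Induced Y Q) restrict
  restrict-locSurj Q-irr (hom , surj) = (λ u v → hom (proj₁ u) (proj₁ v)) , lift-preimage
    where
    lift-preimage : ∀ u y → Adj Y (φ (proj₁ u)) (proj₁ y) →
      ∃ λ v → Adj X (proj₁ u) (proj₁ v) × restrict v ≡ y
    lift-preimage (u , _) (y , q) u→y with surj u y u→y
    ... | v , u→v , refl = (v , from (P⇔Q∘φ v) q) , u→v , cong (φ v ,_) (Q-irr _ _)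

  restrict-locBij : Irrelevant P → Irrelevant Q → LocBij X Y φ →
    LocBij (Induced X P) (Induced Y Q) restrict
  restrict-locBij P-irr Q-irr (ls , inj) = restrict-locSurj Q-irr ls , restrict-inj
    where
    restrict-inj : ∀ u v w → Adj X (proj₁ u) (proj₁ v) → Adj X (proj₁ u) (proj₁ w) →
      restrict v ≡ restrict w → v ≡ w
    restrict-inj (u , _) (v , p) (w , p′) u→v u→w eq
      with refl ← inj u v w u→v u→w (cong proj₁ eq) = cong (v ,_) (P-irr p p′)

decSubset : {P : Pred (Fin n) ℓ} → Decidable P → Subset n
decSubset P? = tabulate (does ∘ P?)

∈-decSubset : {P : Pred (Fin n) ℓ} (P? : Decidable P) {x : Fin n} → x ∈ decSubset P? ⇔ P x
∈-decSubset {P = P} P? {x} = mk⇔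
  (λ x∈ → invert (subst (Reflects (P x)) (does≡true x∈) (proof (P? x))))
  (λ px → lookup⇒[]= x _ (trans lookup-does (dec-true (P? x) px)))
  where
  lookup-does : lookup (decSubset P?) x ≡ does (P? x)
  lookup-does = lookup∘tabulate (does ∘ P?) x
  does≡true : x ∈ decSubset P? → does (P? x) ≡ true
  does≡true x∈ = trans (sym lookup-does) ([]=⇒lookup x∈)

∈-irrelevant : {p : Subset n} → Irrelevant (_∈ p)
∈-irrelevant = []=-irrelevant

lemma9 : ∀ {n m} (G : FinGraph n) (H : FinGraph m) (c k : ℕ) →
    Loopless G → 0 < n → 0 < m →
    Connected (toGraph G) → Connected (toGraph H) →
    (∃ λ S → DeletionSet G c S × ∣ S ∣ ≤ k) →
    (φ : Fin n → Fin m) → LocSurj (toGraph G) (toGraph H) φ →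
    Σ (Subset n) λ D →
    Σ (Σ (Fin n) (λ v → v ∈ D) → Σ (Fin m) (InD H (k + c))) λ φP →
      (∀ v → v ∈ D → InD G (k + c) v)
      × LocSurj (Induced (toGraph G) (λ v → v ∈ D))
                (Induced (toGraph H) (InD H (k + c))) φP
      × Augments (λ v → v ∈ D) (InD H (k + c)) φ φP
      × (LocBij (toGraph G) (toGraph H) φ →
          (∀ v → v ∈ D ⇔ InD G (k + c) v)
          × LocBij (Induced (toGraph G) (λ v → v ∈ D))
                   (Induced (toGraph H) (InD H (k + c))) φP)
lemma9 G H c k _ _ _ _ _ _ φ ls =
  D , restrict , D⊆D_G , restrict-locSurj ≤-irrelevant ls , (D⇔φ⁻¹D_H , λ _ _ → refl) ,
  λ lb → (λ v → mk⇔ (D⊆D_G v) (D_G⊆D v lb)) , restrict-locBij ∈-irrelevant ≤-irrelevant lb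
  where
  D_H? : Decidable (InD H (k + c) ∘ φ)
  D_H? v = k + c ≤? deg H (φ v)
  D : Subset _
  D = decSubset D_H?
  D⇔φ⁻¹D_H : ∀ v → v ∈ D ⇔ InD H (k + c) (φ v)
  D⇔φ⁻¹D_H v = ∈-decSubset D_H?
  open Restriction {toGraph G} {toGraph H} {φ} {_∈ D} {InD H (k + c)} D⇔φ⁻¹D_H
  D⊆D_G : ∀ v → v ∈ D → InD G (k + c) v
  D⊆D_G v v∈D = ≤-trans (to (D⇔φ⁻¹D_H v) v∈D) (locSurj⇒deg≤ G H ls v)
  D_G⊆D : ∀ v → LocBij (toGraph G) (toGraph H) φ → InD G (k + c) v → v ∈ D
  D_G⊆D v lb v∈D_G = from (D⇔φ⁻¹D_H v) (subst (k + c ≤_) (sym (locBij⇒deg≡ G H lb v)) v∈D_G)
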